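{- Let $p,q\geq 3$. Suppose there exists a $p$-core of type $(x_1,\dots,x_p)$ and a $q$-core of type $(y_1,\dots,y_q)$. Then there exists a $(p+q-1)$-core of type $(x_1,\dots,x_{p-1},x_p+y_1,y_2,\dots,y_q)$.
   Context: Let $\ell\ge 3$ and let $A_1,\dots,A_\ell$ be pairwise disjoint sets. A family $\mathcal B=(B_1,\dots,B_\ell)$ of sets is an $\ell$-core (with respect to $A_1,\dots,A_\ell$) if (i) each $B_i$ is an $(\ell-1)$-element subset of $A_1\cup\dots\cup A_\ell$ with $B_i\cap A_i=\emptyset$ and $|B_i\cap A_j|=1$ for all $j\neq i$, and (ii) $|B_i\cap B_j|+\ell$ is odd for all $1\le i,j\le\ell$. With $U:=B_1\cup\dots\cup B_\ell$, the type of the core is $(|U\cap A_1|,\dots,|U\cap A_\ell|)$. "There exists an $\ell$-core of type $(z_1,\dots,z_\ell)$" means there exist pairwise disjoint sets $A_1,\dots,A_\ell$ and an $\ell$-core with respect to them of that type. -}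

module Defs where

open import Data.Nat using (ℕ; suc; _+_; _∸_; _%_)
open import Data.Fin using (Fin)
open import Data.Fin.Subset using (Subset; _∩_; _∈_; ⋃; Empty; _⊆_)
open import Data.Fin.Subset using (∣_∣)
open import Data.Vec using (Vec; _∷_; _++_; init; last; head; tail; tabulate; toList; lookup)
open import Data.List using (List)
open import Data.Product using (Σ; ∃; _×_)
open import Relation.Binary.PropositionalEquality using (_≡_; _≢_)
open import Relation.Nullary using (¬_)

PairwiseDisjoint : {N ℓ : ℕ} → (Fin ℓ → Subset N) → Set
PairwiseDisjoint {N} A = ∀ i j → i ≢ j → Empty (A i ∩ A j)

⋃ᶠ : {N ℓ : ℕ} → (Fin ℓ → Subset N) → Subset N
⋃ᶠ {N} F = ⋃ (toList (tabulate F))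

-- B is an ℓ-core with respect to A (the A i pairwise disjoint, enforced separately).
IsCore : {N : ℕ} (ℓ : ℕ) → (A : Fin ℓ → Subset N) → (B : Fin ℓ → Subset N) → Set
IsCore ℓ A B =
  (∀ i → ∣ B i ∣ ≡ ℓ ∸ 1)
  × (∀ i → B i ⊆ ⋃ᶠ A)
  × (∀ i → Empty (B i ∩ A i))
  × (∀ i j → i ≢ j → ∣ B i ∩ A j ∣ ≡ 1)
  × (∀ i j → (∣ B i ∩ B j ∣ + ℓ) % 2 ≡ 1)

coreType : {N : ℕ} (ℓ : ℕ) → (A : Fin ℓ → Subset N) → (B : Fin ℓ → Subset N) → Vec ℕ ℓ
coreType ℓ A B = tabulate (λ i → ∣ ⋃ᶠ B ∩ A i ∣)

-- There exist pairwise disjoint (finite) sets A and an ℓ-core w.r.t. them of type z.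
-- (Only the finitely many elements of U matter, so a finite ground set Fin N is no loss.)
HasCoreOfType : (ℓ : ℕ) → Vec ℕ ℓ → Set
HasCoreOfType ℓ z =
  Σ ℕ λ N → Σ (Fin ℓ → Subset N) λ A → Σ (Fin ℓ → Subset N) λ B →
    PairwiseDisjoint A × IsCore ℓ A B × (coreType ℓ A B ≡ z)

-- (x₁,…,x_{p-1}, x_p + y₁, y₂,…,y_q) for p = suc m, q = suc n; length m + suc n = p + q - 1.
glueType : {m n : ℕ} → Vec ℕ (suc m) → Vec ℕ (suc n) → Vec ℕ (m + suc n)
glueType x y = init x ++ ((last x + head y) ∷ tail y)

-- Glue the two cores along the last set A (fromℕ m) of the first and the first set A' zero of the
-- second.  Over the disjoint union of the two ground sets, index the new core by the pairs (i , j)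
-- with i the last index or j the first, and put
--   Aᵍ (i , j) = [ j first ] A i ⊎ [ i last ] A' j,      Bᵍ (i , j) = B i ⊎ B' j.
-- Every intersection of these sets splits into a part from each core: for (i , j) ≠ (i' , j') exactly
-- one part of Bᵍ (i , j) ∩ Aᵍ (i' , j') is a singleton and the other is empty,
-- ∣ Bᵍ (i , j) ∣ = (p - 1) + (q - 1), and ∣ Bᵍ ∩ Bᵍ ∣ has the parity of (p + 1) + (q + 1), i.e. of p + q.
-- The union of the Bᵍ is the disjoint union of the two old unions, which gives the type.
module Submission where

open import Defs
open import Data.Nat using (ℕ; suc; _+_; _≤_; _%_; _∸_)
open import Data.Vec using (Vec; []; _∷_; _++_; init; last; tabulate; lookup; here; there)

open import Data.Bool using (_∧_; _∨_)
open import Data.Empty using (⊥-elim)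
open import Data.Fin using (Fin; zero; suc; _↑ˡ_; _↑ʳ_; inject₁; fromℕ)
open import Data.Fin.Properties using (fromℕ≢inject₁; inject₁-injective)
open import Data.Fin.Subset using (Subset; _∩_; _∪_; Empty; _⊆_; ⊥; ∣_∣; inside; outside)
open import Data.Fin.Subset.Properties
  using (Empty-unique; ∉⊥; ⊥⊆; ∣⊥∣≡0; p∩q⊆p; p∩q⊆q; p⊆p∪q; q⊆p∪q; x∈p∪q⁻; ∪-identityˡ; ∪-identityʳ;
         ⊆-refl; ⊆-trans; ⊆-reflexive; ⊆-antisym; drop-∷-⊆)
open import Data.Nat.DivMod using (%-distribˡ-+)
open import Data.Nat.Properties using (+-identityʳ; +-suc)
open import Data.Nat.Tactic.RingSolver using (solve-∀)
open import Data.Product using (∃; _×_; _,_; uncurry)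
open import Data.Sum using ([_,_])
open import Data.Vec.Properties
  using (zipWith-++; lookup-++ˡ; lookup-++ʳ; lookup∘tabulate; tabulate-cong; tabulate∘lookup)
open import Function using (_∘_)
open import Relation.Binary.PropositionalEquality
  using (_≡_; _≢_; refl; sym; trans; subst; cong; cong₂; module ≡-Reasoning)

open ≡-Reasoning

private
  variable
    N M : ℕ

∩-++ : (S S' : Subset N) (T T' : Subset M) → (S ++ T) ∩ (S' ++ T') ≡ (S ∩ S') ++ (T ∩ T')
∩-++ S S' T T' = zipWith-++ _∧_ S T S' T'

∪-++ : (S S' : Subset N) (T T' : Subset M) → (S ++ T) ∪ (S' ++ T') ≡ (S ∪ S') ++ (T ∪ T')
∪-++ S S' T T' = zipWith-++ _∨_ S T S' T'

⊥++⊥ : ∀ N M → ⊥ {N} ++ ⊥ {M} ≡ ⊥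
⊥++⊥ 0       M = refl
⊥++⊥ (suc N) M = cong (outside ∷_) (⊥++⊥ N M)

∣++∣ : (S : Subset N) (T : Subset M) → ∣ S ++ T ∣ ≡ ∣ S ∣ + ∣ T ∣
∣++∣ []            T = refl
∣++∣ (inside ∷ S)  T = cong suc (∣++∣ S T)
∣++∣ (outside ∷ S) T = ∣++∣ S T

∣∩-++∣ : (S S' : Subset N) (T T' : Subset M) → ∣ (S ++ T) ∩ (S' ++ T') ∣ ≡ ∣ S ∩ S' ∣ + ∣ T ∩ T' ∣
∣∩-++∣ S S' T T' = begin
  ∣ (S ++ T) ∩ (S' ++ T') ∣ ≡⟨ cong ∣_∣ (∩-++ S S' T T') ⟩
  ∣ (S ∩ S') ++ (T ∩ T') ∣  ≡⟨ ∣++∣ (S ∩ S') (T ∩ T') ⟩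
  ∣ S ∩ S' ∣ + ∣ T ∩ T' ∣   ∎

++⁺-⊆ : {S S' : Subset N} {T T' : Subset M} → S ⊆ S' → T ⊆ T' → S ++ T ⊆ S' ++ T'
++⁺-⊆ {S = []}    {[]}     _   T⊆T' x∈         = T⊆T' x∈
++⁺-⊆ {S = _ ∷ _} {_ ∷ _}  S⊆S' _   {zero}  here with S⊆S' here
... | here = here
++⁺-⊆ {S = _ ∷ _} {_ ∷ _}  S⊆S' T⊆T' {suc _} (there x∈) = there (++⁺-⊆ (drop-∷-⊆ S⊆S') T⊆T' x∈)

++⊥-⊆ : (S : Subset N) (T : Subset M) → S ++ ⊥ ⊆ S ++ T
++⊥-⊆ S T = ++⁺-⊆ {S = S} {S} {⊥} {T} ⊆-refl ⊥⊆

⊥++-⊆ : (S : Subset N) (T : Subset M) → ⊥ ++ T ⊆ S ++ T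
⊥++-⊆ S T = ++⁺-⊆ {S = ⊥} {S} {T} {T} ⊥⊆ ⊆-refl

∪-lub : {p q r : Subset N} → p ⊆ r → q ⊆ r → p ∪ q ⊆ r
∪-lub {p = p} {q} p⊆r q⊆r = [ p⊆r , q⊆r ] ∘ x∈p∪q⁻ p q

Empty-⊥ : Empty (⊥ {N})
Empty-⊥ (_ , x∈⊥) = ∉⊥ x∈⊥

Empty-⊥∩ : (p : Subset N) → Empty (⊥ ∩ p)
Empty-⊥∩ p (_ , x∈) = ∉⊥ (p∩q⊆p ⊥ p x∈)

Empty-∩⊥ : (p : Subset N) → Empty (p ∩ ⊥)
Empty-∩⊥ p (_ , x∈) = ∉⊥ (p∩q⊆q p ⊥ x∈)

Empty-++ : ∀ {N M} {S : Subset N} {T : Subset M} → Empty S → Empty T → Empty (S ++ T)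
Empty-++ {N} {M} S-empty T-empty rewrite Empty-unique S-empty | Empty-unique T-empty | ⊥++⊥ N M = Empty-⊥

Empty-∩-++ : (S S' : Subset N) (T T' : Subset M) →
             Empty (S ∩ S') → Empty (T ∩ T') → Empty ((S ++ T) ∩ (S' ++ T'))
Empty-∩-++ S S' T T' e e' rewrite ∩-++ S S' T T' = Empty-++ e e'

Empty⇒∣∣≡0 : ∀ {N} {p : Subset N} → Empty p → ∣ p ∣ ≡ 0
Empty⇒∣∣≡0 {N} p-empty rewrite Empty-unique p-empty = ∣⊥∣≡0 N

++-split : (S : Subset N) (T : Subset M) → S ++ T ≡ (S ++ ⊥) ∪ (⊥ ++ T)
++-split S T = begin
  S ++ T               ≡⟨ cong₂ _++_ (∪-identityʳ S) (∪-identityˡ T) ⟨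
  (S ∪ ⊥) ++ (⊥ ∪ T)   ≡⟨ ∪-++ S ⊥ ⊥ T ⟨
  (S ++ ⊥) ∪ (⊥ ++ T)  ∎

⋃ᶠ-ub : ∀ {ℓ} (F : Fin ℓ → Subset N) i → F i ⊆ ⋃ᶠ F
⋃ᶠ-ub F zero    = p⊆p∪q _
⋃ᶠ-ub F (suc i) = q⊆p∪q (F zero) _ ∘ ⋃ᶠ-ub (F ∘ suc) i

⋃ᶠ-lub : ∀ {ℓ} (F : Fin ℓ → Subset N) {S : Subset N} → (∀ i → F i ⊆ S) → ⋃ᶠ F ⊆ S
⋃ᶠ-lub {ℓ = 0}     F _     = ⊥⊆
⋃ᶠ-lub {ℓ = suc ℓ} F F⊆S = ∪-lub (F⊆S zero) (⋃ᶠ-lub (F ∘ suc) (F⊆S ∘ suc))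

⋃ᶠ-⊥ : ∀ N ℓ → ⋃ᶠ {N} {ℓ} (λ _ → ⊥) ≡ ⊥
⋃ᶠ-⊥ N 0       = refl
⋃ᶠ-⊥ N (suc ℓ) = trans (cong (⊥ ∪_) (⋃ᶠ-⊥ N ℓ)) (∪-identityˡ ⊥)

⋃ᶠ-++ : ∀ {ℓ} (F : Fin ℓ → Subset N) (G : Fin ℓ → Subset M) →
        ⋃ᶠ (λ i → F i ++ G i) ≡ ⋃ᶠ F ++ ⋃ᶠ G
⋃ᶠ-++ {N} {M} {ℓ = 0} F G = sym (⊥++⊥ N M)
⋃ᶠ-++ {ℓ = suc ℓ} F G = begin
  (F zero ++ G zero) ∪ ⋃ᶠ (λ i → F (suc i) ++ G (suc i))
    ≡⟨ cong ((F zero ++ G zero) ∪_) (⋃ᶠ-++ (F ∘ suc) (G ∘ suc)) ⟩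
  (F zero ++ G zero) ∪ (⋃ᶠ (F ∘ suc) ++ ⋃ᶠ (G ∘ suc))
    ≡⟨ ∪-++ (F zero) _ (G zero) _ ⟩
  ⋃ᶠ F ++ ⋃ᶠ G
    ∎

⋃ᶠ-++-⊆ : ∀ {ℓ ℓ' ℓ''} (F : Fin ℓ → Subset N) (G : Fin ℓ' → Subset M) (H : Fin ℓ'' → Subset (N + M)) →
          (∀ i → ∃ λ k → F i ++ ⊥ ⊆ H k) → (∀ j → ∃ λ k → ⊥ ++ G j ⊆ H k) →
          ⋃ᶠ F ++ ⋃ᶠ G ⊆ ⋃ᶠ H
⋃ᶠ-++-⊆ {N} {M} {ℓ} {ℓ'} F G H F⊆H G⊆H =
  ⊆-trans (⊆-reflexive (++-split (⋃ᶠ F) (⋃ᶠ G))) (∪-lub F-part G-part)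
  where
  covered : ∀ {S} → ∃ (λ k → S ⊆ H k) → S ⊆ ⋃ᶠ H
  covered (k , S⊆Hk) = ⋃ᶠ-ub H k ∘ S⊆Hk

  F-part : ⋃ᶠ F ++ ⊥ ⊆ ⋃ᶠ H
  F-part = ⊆-trans (⊆-reflexive (begin
    ⋃ᶠ F ++ ⊥                    ≡⟨ cong (⋃ᶠ F ++_) (⋃ᶠ-⊥ M ℓ) ⟨
    ⋃ᶠ F ++ ⋃ᶠ {M} {ℓ} (λ _ → ⊥) ≡⟨ ⋃ᶠ-++ F (λ _ → ⊥) ⟨
    ⋃ᶠ (λ i → F i ++ ⊥)          ∎)) (⋃ᶠ-lub _ (λ i → covered (F⊆H i)))

  G-part : ⊥ ++ ⋃ᶠ G ⊆ ⋃ᶠ H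
  G-part = ⊆-trans (⊆-reflexive (begin
    ⊥ ++ ⋃ᶠ G                    ≡⟨ cong (_++ ⋃ᶠ G) (⋃ᶠ-⊥ N ℓ') ⟨
    ⋃ᶠ {N} {ℓ'} (λ _ → ⊥) ++ ⋃ᶠ G ≡⟨ ⋃ᶠ-++ (λ _ → ⊥) G ⟨
    ⋃ᶠ (λ j → ⊥ ++ G j)          ∎)) (⋃ᶠ-lub _ (λ j → covered (G⊆H j)))

lookup-init : ∀ {A : Set} {n} (xs : Vec A (suc n)) i → lookup (init xs) i ≡ lookup xs (inject₁ i)
lookup-init (_ ∷ _ ∷ _)  zero    = refl
lookup-init (_ ∷ y ∷ xs) (suc i) = lookup-init (y ∷ xs) i

last≡lookup-fromℕ : ∀ {A : Set} {n} (xs : Vec A (suc n)) → last xs ≡ lookup xs (fromℕ n)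
last≡lookup-fromℕ (_ ∷ [])     = refl
last≡lookup-fromℕ (_ ∷ y ∷ xs) = last≡lookup-fromℕ (y ∷ xs)

lookup-glueType-↑ˡ : ∀ {m n} (x : Vec ℕ (suc m)) (y : Vec ℕ (suc n)) i →
                     lookup (glueType x y) (i ↑ˡ suc n) ≡ lookup x (inject₁ i)
lookup-glueType-↑ˡ x y i = trans (lookup-++ˡ (init x) _ i) (lookup-init x i)

lookup-glueType-joint : ∀ {m n} (x : Vec ℕ (suc m)) (y : Vec ℕ (suc n)) →
                        lookup (glueType x y) (m ↑ʳ zero) ≡ lookup x (fromℕ m) + lookup y zero
lookup-glueType-joint x (y₀ ∷ ys) =
  trans (lookup-++ʳ (init x) _ zero) (cong (_+ y₀) (last≡lookup-fromℕ x))

lookup-glueType-↑ʳ-suc : ∀ {m n} (x : Vec ℕ (suc m)) (y : Vec ℕ (suc n)) j →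
                         lookup (glueType x y) (m ↑ʳ suc j) ≡ lookup y (suc j)
lookup-glueType-↑ʳ-suc x (_ ∷ _) j = lookup-++ʳ (init x) _ (suc j)

data LastView (m : ℕ) : Fin (suc m) → Set where
  notLast : (i : Fin m) → LastView m (inject₁ i)
  isLast  : LastView m (fromℕ m)

lastView : ∀ m (i : Fin (suc m)) → LastView m i
lastView 0       zero    = isLast
lastView (suc m) zero    = notLast zero
lastView (suc m) (suc i) with lastView m i
... | notLast j = notLast (suc j)
... | isLast    = isLast

-- Fin (m + suc n) as the pairs (i , j) ∈ Fin (suc m) × Fin (suc n) with i = fromℕ m or j = zero,
-- in the order of glueType; fstᵍ and sndᵍ below are the two coordinates.
data Glued (m n : ℕ) : Fin (m + suc n) → Set where
  left  : (i : Fin m) → Glued m n (i ↑ˡ suc n)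
  joint : Glued m n (m ↑ʳ zero)
  right : (j : Fin n) → Glued m n (m ↑ʳ suc j)

Glued-suc : ∀ {m n k} → Glued m n k → Glued (suc m) n (suc k)
Glued-suc (left i)  = left (suc i)
Glued-suc joint     = joint
Glued-suc (right j) = right j

glued : ∀ m n (k : Fin (m + suc n)) → Glued m n k
glued 0       n zero    = joint
glued 0       n (suc j) = right j
glued (suc m) n zero    = left zero
glued (suc m) n (suc k) = Glued-suc (glued m n k)

glued-left : ∀ {m n} (i : Fin m) → glued m n (i ↑ˡ suc n) ≡ left i
glued-left {suc m} zero    = refl
glued-left {suc m} (suc i) = cong Glued-suc (glued-left i)

glued-joint : ∀ m n → glued m n (m ↑ʳ zero) ≡ joint
glued-joint 0       n = refl
glued-joint (suc m) n = cong Glued-suc (glued-joint m n)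

glued-right : ∀ m {n} (j : Fin n) → glued m n (m ↑ʳ suc j) ≡ right j
glued-right 0       j = refl
glued-right (suc m) j = cong Glued-suc (glued-right m j)

fstᵍ : ∀ {m n k} → Glued m n k → Fin (suc m)
fstᵍ (left i)      = inject₁ i
fstᵍ {m} joint     = fromℕ m
fstᵍ {m} (right _) = fromℕ m

sndᵍ : ∀ {m n k} → Glued m n k → Fin (suc n)
sndᵍ (left _)  = zero
sndᵍ joint     = zero
sndᵍ (right j) = suc j

odd-of-even-suc : ∀ t → suc t % 2 ≡ 0 → t % 2 ≡ 1
odd-of-even-suc 1             _        = refl
odd-of-even-suc (suc (suc t)) even-sst = odd-of-even-suc t even-sst

odd-glue : ∀ a b p q → (a + suc p) % 2 ≡ 1 → (b + suc q) % 2 ≡ 1 → (a + b + (p + suc q)) % 2 ≡ 1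
odd-glue a b p q odd₁ odd₂ = odd-of-even-suc (a + b + (p + suc q)) (begin
  suc (a + b + (p + suc q)) % 2             ≡⟨ cong (_% 2) (rearrange a b p q) ⟩
  (a + suc p + (b + suc q)) % 2             ≡⟨ %-distribˡ-+ (a + suc p) (b + suc q) 2 ⟩
  ((a + suc p) % 2 + (b + suc q) % 2) % 2   ≡⟨ cong₂ (λ u v → (u + v) % 2) odd₁ odd₂ ⟩
  0                                         ∎)
  where
  rearrange : ∀ a b p q → suc (a + b + (p + suc q)) ≡ a + suc p + (b + suc q)
  rearrange = solve-∀

lookup-coreType : ∀ {N} ℓ (A B : Fin ℓ → Subset N) i → lookup (coreType ℓ A B) i ≡ ∣ ⋃ᶠ B ∩ A i ∣
lookup-coreType ℓ A B = lookup∘tabulate (λ i → ∣ ⋃ᶠ B ∩ A i ∣)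

module Gluing {N M m n : ℕ} (A B : Fin (suc m) → Subset N) (A' B' : Fin (suc n) → Subset M) where

  Aˡ : ∀ {k} → Glued m n k → Subset N
  Aˡ (left i)  = A (inject₁ i)
  Aˡ joint     = A (fromℕ m)
  Aˡ (right _) = ⊥

  Aʳ : ∀ {k} → Glued m n k → Subset M
  Aʳ (left _)  = ⊥
  Aʳ joint     = A' zero
  Aʳ (right j) = A' (suc j)

  Aᵛ Bᵛ : ∀ {k} → Glued m n k → Subset (N + M)
  Aᵛ v = Aˡ v ++ Aʳ v
  Bᵛ v = B (fstᵍ v) ++ B' (sndᵍ v)

  Aᵍ Bᵍ : Fin (m + suc n) → Subset (N + M)
  Aᵍ k = Aᵛ (glued m n k)
  Bᵍ k = Bᵛ (glued m n k)

  Aᵍ-pairwiseDisjoint : PairwiseDisjoint A → PairwiseDisjoint A' → PairwiseDisjoint Aᵍ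
  Aᵍ-pairwiseDisjoint disj disj' k k' k≢k' =
    uncurry (Empty-∩-++ (Aˡ v) (Aˡ w) (Aʳ v) (Aʳ w)) (disjointᵛ v w k≢k')
    where
    v = glued m n k
    w = glued m n k'
    disjointᵛ : ∀ {k k'} (v : Glued m n k) (w : Glued m n k') → k ≢ k' →
                Empty (Aˡ v ∩ Aˡ w) × Empty (Aʳ v ∩ Aʳ w)
    disjointᵛ (left i)  (left i')  ne = disj _ _ (ne ∘ cong (_↑ˡ suc n) ∘ inject₁-injective) , Empty-∩⊥ ⊥
    disjointᵛ (left i)  joint      _  = disj _ _ (fromℕ≢inject₁ ∘ sym) , Empty-⊥∩ _
    disjointᵛ (left i)  (right j)  _  = Empty-∩⊥ _ , Empty-⊥∩ _
    disjointᵛ joint     (left i)   _  = disj _ _ fromℕ≢inject₁ , Empty-∩⊥ _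
    disjointᵛ joint     joint      ne = ⊥-elim (ne refl)
    disjointᵛ joint     (right j)  _  = Empty-∩⊥ _ , disj' _ _ λ ()
    disjointᵛ (right j) (left i)   _  = Empty-⊥∩ _ , Empty-∩⊥ _
    disjointᵛ (right j) joint      _  = Empty-⊥∩ _ , disj' _ _ λ ()
    disjointᵛ (right j) (right j') ne = Empty-⊥∩ _ , disj' _ _ (ne ∘ cong (m ↑ʳ_))

  Bᵍ-Aᵍ-disjoint : (∀ i → Empty (B i ∩ A i)) → (∀ j → Empty (B' j ∩ A' j)) →
                   ∀ k → Empty (Bᵍ k ∩ Aᵍ k)
  Bᵍ-Aᵍ-disjoint empty empty' k =
    uncurry (Empty-∩-++ (B (fstᵍ v)) (Aˡ v) (B' (sndᵍ v)) (Aʳ v)) (diagonalᵛ v)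
    where
    v = glued m n k
    diagonalᵛ : ∀ {k} (v : Glued m n k) → Empty (B (fstᵍ v) ∩ Aˡ v) × Empty (B' (sndᵍ v) ∩ Aʳ v)
    diagonalᵛ (left i)  = empty _ , Empty-∩⊥ _
    diagonalᵛ joint     = empty _ , empty' _
    diagonalᵛ (right j) = Empty-∩⊥ _ , empty' _

  Bᵍ-Aᵍ-meet : (∀ i → Empty (B i ∩ A i)) → (∀ j → Empty (B' j ∩ A' j)) →
               (∀ i i' → i ≢ i' → ∣ B i ∩ A i' ∣ ≡ 1) → (∀ j j' → j ≢ j' → ∣ B' j ∩ A' j' ∣ ≡ 1) →
               ∀ k k' → k ≢ k' → ∣ Bᵍ k ∩ Aᵍ k' ∣ ≡ 1
  Bᵍ-Aᵍ-meet empty empty' one one' k k' k≢k' =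
    trans (∣∩-++∣ (B (fstᵍ v)) (Aˡ w) (B' (sndᵍ v)) (Aʳ w)) (meetᵛ v w k≢k')
    where
    v = glued m n k
    w = glued m n k'
    meetᵛ : ∀ {k k'} (v : Glued m n k) (w : Glued m n k') → k ≢ k' →
            ∣ B (fstᵍ v) ∩ Aˡ w ∣ + ∣ B' (sndᵍ v) ∩ Aʳ w ∣ ≡ 1
    meetᵛ (left i)  (left i')  ne = cong₂ _+_
      (one (inject₁ i) (inject₁ i') (ne ∘ cong (_↑ˡ suc n) ∘ inject₁-injective))
      (Empty⇒∣∣≡0 (Empty-∩⊥ (B' zero)))
    meetᵛ (left i)  joint      _  = cong₂ _+_
      (one (inject₁ i) (fromℕ m) (fromℕ≢inject₁ ∘ sym)) (Empty⇒∣∣≡0 (empty' zero))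
    meetᵛ (left i)  (right j)  _  = cong₂ _+_
      (Empty⇒∣∣≡0 (Empty-∩⊥ (B (inject₁ i)))) (one' zero (suc j) λ ())
    meetᵛ joint     (left i)   _  = cong₂ _+_
      (one (fromℕ m) (inject₁ i) fromℕ≢inject₁) (Empty⇒∣∣≡0 (Empty-∩⊥ (B' zero)))
    meetᵛ joint     joint      ne = ⊥-elim (ne refl)
    meetᵛ joint     (right j)  _  = cong₂ _+_
      (Empty⇒∣∣≡0 (Empty-∩⊥ (B (fromℕ m)))) (one' zero (suc j) λ ())
    meetᵛ (right j) (left i)   _  = cong₂ _+_
      (one (fromℕ m) (inject₁ i) fromℕ≢inject₁) (Empty⇒∣∣≡0 (Empty-∩⊥ (B' (suc j))))
    meetᵛ (right j) joint      _  = cong₂ _+_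
      (Empty⇒∣∣≡0 (empty (fromℕ m))) (one' (suc j) zero λ ())
    meetᵛ (right j) (right j') ne = cong₂ _+_
      (Empty⇒∣∣≡0 (Empty-∩⊥ (B (fromℕ m)))) (one' (suc j) (suc j') (ne ∘ cong (m ↑ʳ_)))

  Bᵍ-size : (∀ i → ∣ B i ∣ ≡ m) → (∀ j → ∣ B' j ∣ ≡ n) → ∀ k → ∣ Bᵍ k ∣ ≡ m + suc n ∸ 1
  Bᵍ-size size size' k = begin
    ∣ B (fstᵍ v) ++ B' (sndᵍ v) ∣      ≡⟨ ∣++∣ (B (fstᵍ v)) (B' (sndᵍ v)) ⟩
    ∣ B (fstᵍ v) ∣ + ∣ B' (sndᵍ v) ∣   ≡⟨ cong₂ _+_ (size _) (size' _) ⟩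
    m + n                              ≡⟨ cong (_∸ 1) (+-suc m n) ⟨
    m + suc n ∸ 1                      ∎
    where v = glued m n k

  Bᵍ-odd : (∀ i i' → (∣ B i ∩ B i' ∣ + suc m) % 2 ≡ 1) → (∀ j j' → (∣ B' j ∩ B' j' ∣ + suc n) % 2 ≡ 1) →
           ∀ k k' → (∣ Bᵍ k ∩ Bᵍ k' ∣ + (m + suc n)) % 2 ≡ 1
  Bᵍ-odd odd odd' k k' =
    subst (λ c → (c + (m + suc n)) % 2 ≡ 1)
          (sym (∣∩-++∣ (B (fstᵍ v)) (B (fstᵍ w)) (B' (sndᵍ v)) (B' (sndᵍ w))))
          (odd-glue ∣ B (fstᵍ v) ∩ B (fstᵍ w) ∣ ∣ B' (sndᵍ v) ∩ B' (sndᵍ w) ∣ m n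
                    (odd (fstᵍ v) (fstᵍ w)) (odd' (sndᵍ v) (sndᵍ w)))
    where
    v = glued m n k
    w = glued m n k'

  private
    ⊆-at : (F : ∀ {k} → Glued m n k → Subset (N + M)) {k : Fin (m + suc n)} {v : Glued m n k}
           {S : Subset (N + M)} → glued m n k ≡ v → S ⊆ F v → ∃ λ k' → S ⊆ F (glued m n k')
    ⊆-at F {k} glued≡v S⊆ = k , ⊆-trans S⊆ (⊆-reflexive (cong F (sym glued≡v)))

  ⋃A⊆⋃Aᵍ : ⋃ᶠ A ++ ⋃ᶠ A' ⊆ ⋃ᶠ Aᵍ
  ⋃A⊆⋃Aᵍ = ⋃ᶠ-++-⊆ A A' Aᵍ A-covered A'-covered
    where
    A-covered : ∀ i → ∃ λ k → A i ++ ⊥ ⊆ Aᵍ k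
    A-covered i with lastView m i
    ... | notLast i' = ⊆-at Aᵛ (glued-left i') ⊆-refl
    ... | isLast     = ⊆-at Aᵛ (glued-joint m n) (++⊥-⊆ (A (fromℕ m)) (A' zero))
    A'-covered : ∀ j → ∃ λ k → ⊥ ++ A' j ⊆ Aᵍ k
    A'-covered zero    = ⊆-at Aᵛ (glued-joint m n) (⊥++-⊆ (A (fromℕ m)) (A' zero))
    A'-covered (suc j) = ⊆-at Aᵛ (glued-right m j) ⊆-refl

  ⋃Bᵍ : ⋃ᶠ Bᵍ ≡ ⋃ᶠ B ++ ⋃ᶠ B'
  ⋃Bᵍ = ⊆-antisym (⋃ᶠ-lub Bᵍ (λ k → ++⁺-⊆ (⋃ᶠ-ub B _) (⋃ᶠ-ub B' _)))
                  (⋃ᶠ-++-⊆ B B' Bᵍ B-covered B'-covered)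
    where
    B-covered : ∀ i → ∃ λ k → B i ++ ⊥ ⊆ Bᵍ k
    B-covered i with lastView m i
    ... | notLast i' = ⊆-at Bᵛ (glued-left i') (++⊥-⊆ (B (inject₁ i')) (B' zero))
    ... | isLast     = ⊆-at Bᵛ (glued-joint m n) (++⊥-⊆ (B (fromℕ m)) (B' zero))
    B'-covered : ∀ j → ∃ λ k → ⊥ ++ B' j ⊆ Bᵍ k
    B'-covered zero    = ⊆-at Bᵛ (glued-joint m n) (⊥++-⊆ (B (fromℕ m)) (B' zero))
    B'-covered (suc j) = ⊆-at Bᵛ (glued-right m j) (⊥++-⊆ (B (fromℕ m)) (B' (suc j)))

  Bᵍ-isCore : IsCore (suc m) A B → IsCore (suc n) A' B' → IsCore (m + suc n) Aᵍ Bᵍ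
  Bᵍ-isCore (size , ⊆⋃A , empty , one , odd) (size' , ⊆⋃A' , empty' , one' , odd') =
    Bᵍ-size size size' ,
    (λ k → ⊆-trans (++⁺-⊆ (⊆⋃A _) (⊆⋃A' _)) ⋃A⊆⋃Aᵍ) ,
    Bᵍ-Aᵍ-disjoint empty empty' ,
    Bᵍ-Aᵍ-meet empty empty' one one' ,
    Bᵍ-odd odd odd'

  Bᵍ-coreType : coreType (m + suc n) Aᵍ Bᵍ ≡ glueType (coreType (suc m) A B) (coreType (suc n) A' B')
  Bᵍ-coreType = begin
    tabulate (λ k → ∣ ⋃ᶠ Bᵍ ∩ Aᵍ k ∣)          ≡⟨ tabulate-cong (λ k → cong (λ U → ∣ U ∩ Aᵍ k ∣) ⋃Bᵍ) ⟩
    tabulate (λ k → ∣ (U ++ U') ∩ Aᵍ k ∣)      ≡⟨ tabulate-cong (λ k → typeᵛ (glued m n k)) ⟩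
    tabulate (lookup (glueType x y))           ≡⟨ tabulate∘lookup (glueType x y) ⟩
    glueType x y                               ∎
    where
    U = ⋃ᶠ B
    U' = ⋃ᶠ B'
    x = coreType (suc m) A B
    y = coreType (suc n) A' B'
    typeᵛ : ∀ {k} (v : Glued m n k) → ∣ (U ++ U') ∩ Aᵛ v ∣ ≡ lookup (glueType x y) k
    typeᵛ (left i) = begin
      ∣ (U ++ U') ∩ (A (inject₁ i) ++ ⊥) ∣  ≡⟨ ∣∩-++∣ U (A (inject₁ i)) U' ⊥ ⟩
      ∣ U ∩ A (inject₁ i) ∣ + ∣ U' ∩ ⊥ ∣    ≡⟨ cong (∣ U ∩ A (inject₁ i) ∣ +_) (Empty⇒∣∣≡0 (Empty-∩⊥ U')) ⟩
      ∣ U ∩ A (inject₁ i) ∣ + 0             ≡⟨ +-identityʳ _ ⟩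
      ∣ U ∩ A (inject₁ i) ∣                 ≡⟨ lookup-coreType (suc m) A B (inject₁ i) ⟨
      lookup x (inject₁ i)                  ≡⟨ lookup-glueType-↑ˡ x y i ⟨
      lookup (glueType x y) (i ↑ˡ suc n)    ∎
    typeᵛ joint = begin
      ∣ (U ++ U') ∩ (A (fromℕ m) ++ A' zero) ∣   ≡⟨ ∣∩-++∣ U (A (fromℕ m)) U' (A' zero) ⟩
      ∣ U ∩ A (fromℕ m) ∣ + ∣ U' ∩ A' zero ∣     ≡⟨ cong₂ _+_ (lookup-coreType (suc m) A B (fromℕ m))
                                                              (lookup-coreType (suc n) A' B' zero) ⟨
      lookup x (fromℕ m) + lookup y zero         ≡⟨ lookup-glueType-joint x y ⟨
      lookup (glueType x y) (m ↑ʳ zero)          ∎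
    typeᵛ (right j) = begin
      ∣ (U ++ U') ∩ (⊥ ++ A' (suc j)) ∣    ≡⟨ ∣∩-++∣ U ⊥ U' (A' (suc j)) ⟩
      ∣ U ∩ ⊥ ∣ + ∣ U' ∩ A' (suc j) ∣      ≡⟨ cong (_+ ∣ U' ∩ A' (suc j) ∣) (Empty⇒∣∣≡0 (Empty-∩⊥ U)) ⟩
      ∣ U' ∩ A' (suc j) ∣                  ≡⟨ lookup-coreType (suc n) A' B' (suc j) ⟨
      lookup y (suc j)                     ≡⟨ lookup-glueType-↑ʳ-suc x y j ⟨
      lookup (glueType x y) (m ↑ʳ suc j)   ∎

lemma3p4 : (m n : ℕ) → 3 ≤ suc m → 3 ≤ suc n →
    (x : Vec ℕ (suc m)) → (y : Vec ℕ (suc n)) →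
    HasCoreOfType (suc m) x → HasCoreOfType (suc n) y →
    HasCoreOfType (m + suc n) (glueType x y)
-- The gluing needs no lower bound on p and q.
lemma3p4 m n _ _ _ _ (N , A , B , disjoint , core , refl) (M , A' , B' , disjoint' , core' , refl) =
  N + M , Aᵍ , Bᵍ , Aᵍ-pairwiseDisjoint disjoint disjoint' , Bᵍ-isCore core core' , Bᵍ-coreType
  where open Gluing A B A' B'
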